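{- For every specification $\sigma$ expressed in $C^-$ over inputs consisting of $n$ bits, the counterexample-guided refinement algorithm described below, instantiated with $C^-$ as background theory and equipped with the stopping condition (terminate with verdict "unsatisfiable" once the candidate program length would have to exceed $2^n$), terminates.
   Context: $C^-$ is the fragment of C consisting of programs in which all loops have constant bounds, all recursion is limited to constant depth, and all arrays are statically allocated with constant size (nondeterministic values, assumptions and arbitrary-width types are allowed); safety of $C^-$ programs is decidable (e.g. by bounded model checking). The counterexample-guided refinement algorithm maintains a finite set $\mathrm{inputs}$, initially empty, and loops: (SYNTH) find a program $P$, searching by increasing program length, such that $\bigwedge_{i \in \mathrm{inputs}} \sigma(i, P)$ holds, or report that none exists; (VERIF) decide $\exists x . \lnot \sigma(x, P)$; if unsatisfiable, return $P$; otherwise add the counterexample $x$ to $\mathrm{inputs}$ and repeat. Programs are finite, loop-free, non-recursive lists of instructions in SSA form, each instruction an opcode (including equality test and if-then-else) applied to operands that are constants, inputs, or results of earlier instructions. -}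

module Defs where

open import Data.Nat using (ℕ; zero; suc; _≤_; _<_; _^_)
open import Data.Fin using (Fin)
open import Data.Bool using (Bool; true; false)
open import Data.Vec using (Vec)
open import Data.List using (List; []; _∷_)
open import Data.List.Relation.Unary.All using (All)
open import Data.Product using (Σ; ∃)
open import Relation.Binary.PropositionalEquality using (_≡_)
open import Relation.Nullary using (¬_)

-- A language fixes a finite set of opcodes (Fin numOps) with arities,
-- the bit-width of constants, and the number of program inputs.
-- (Opcode semantics is irrelevant here: the specification sees P only
-- through the decidable predicate σ below.)

record Language : Set where
  field
    numOps    : ℕ
    arity     : Fin numOps → ℕ
    width     : ℕ
    numInputs : ℕ

module _ (L : Language) where
  open Language L

  data Operand (i : ℕ) : Set where
    const : Vec Bool width → Operand i
    input : Fin numInputs → Operand i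
    res   : Fin i → Operand i

  Instr : ℕ → Set
  Instr i = Σ (Fin numOps) λ o → Vec (Operand i) (arity o)

  data SSA : ℕ → Set where
    []   : SSA zero
    _∷ʳ_ : ∀ {ℓ} → SSA ℓ → Instr ℓ → SSA (suc ℓ)

  record Program : Set where
    constructor prog
    field
      len  : ℕ
      body : SSA len

open Program public

module CEGIS (L : Language) (n : ℕ) (σ : Vec Bool n → Program L → Bool) where

  Input : Set
  Input = Vec Bool n

  AllSat : List Input → Program L → Set
  AllSat is P = All (λ i → σ i P ≡ true) is

  data Result : Set where
    unsat : Result
    found : Program L → Result

  data State : Set where
    synth : List Input → State
    verif : List Input → Program L → State
    halt  : Result → State

  data Step : State → State → Set where
    synth-found : ∀ {is} (P : Program L) →
      len P ≤ 2 ^ n → AllSat is P →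
      (∀ (Q : Program L) → len Q < len P → ¬ AllSat is Q) →
      Step (synth is) (verif is P)
    synth-none : ∀ {is} →
      (∀ (Q : Program L) → len Q ≤ 2 ^ n → ¬ AllSat is Q) →
      Step (synth is) (halt unsat)
    verif-ok : ∀ {is} {P} → (∀ (x : Input) → σ x P ≡ true) →
      Step (verif is P) (halt (found P))
    verif-cex : ∀ {is} {P} (x : Input) → σ x P ≡ false →
      Step (verif is P) (synth (x ∷ is))

  -- Termination: every execution from s is finite and ends in a verdict
  -- (no infinite runs, and no reachable state is stuck).
  data Terminates : State → Set where
    done : ∀ r → Terminates (halt r)
    step : ∀ {s} → (∃ λ s′ → Step s s′) →
           (∀ s′ → Step s s′ → Terminates s′) → Terminates s

  initial : State
  initial = synth []

-- Every candidate handed to VERIF satisfies σ on all inputs collected so far, so a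
-- counterexample is always a new input: the number of n-bit inputs not yet collected
-- strictly decreases along each SYNTH–VERIF round and can do so at most 2^n times.
-- Each step is also always possible, because programs of a fixed length and n-bit
-- inputs form finite, exhaustively searchable types; hence the search for a shortest
-- consistent program of length ≤ 2^n, and the search for a counterexample, both decide.
module Submission where

open import Defs
open import Level using (0ℓ)
open import Data.Nat using (ℕ; zero; suc; _≤_; _<_; _^_; _+_; z≤n; s≤s)
open import Data.Nat.Properties using (≤-refl; m≤n⇒m≤1+n; m≤n⇒m<n∨m≡n; +-mono-≤; +-mono-<-≤; +-mono-≤-<)
open import Data.Nat.Induction using (<-wellFounded)
open import Induction.WellFounded using (Acc; acc)
open import Data.Bool using (Bool; true; false)
open import Data.Bool.Properties using (¬-not) renaming (_≟_ to _≟ᴮ_)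
import Data.Fin.Properties as Fin
open import Data.Vec using (Vec; []; _∷_)
open import Data.Vec.Properties using (≡-dec)
open import Data.List using (List; []; _∷_)
open import Data.List.Relation.Unary.All as All using (All)
open import Data.List.Relation.Unary.Any as Any using (here; there)
open import Data.List.Membership.Propositional using (_∈_)
open import Data.Product using (Σ; ∃; _×_; _,_)
open import Data.Sum using (_⊎_; inj₁; inj₂; [_,_]′)
open import Data.Empty using (⊥-elim)
open import Relation.Nullary using (¬_; Dec; yes; no)
open import Relation.Nullary.Decidable using (map′; _⊎-dec_)
open import Relation.Unary using (Pred; Decidable)
open import Relation.Binary.PropositionalEquality using (_≡_; refl; sym; trans)

Exhaustible : Set → Set₁
Exhaustible A = ∀ {P : Pred A 0ℓ} → Decidable P → Dec (∃ P)

Bool-exhaustible : Exhaustible Bool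
Bool-exhaustible P? = map′ from to (P? true ⊎-dec P? false)
  where
  from : ∀ {P : Pred Bool 0ℓ} → P true ⊎ P false → ∃ P
  from (inj₁ p) = true , p
  from (inj₂ p) = false , p
  to : ∀ {P : Pred Bool 0ℓ} → ∃ P → P true ⊎ P false
  to (true , p) = inj₁ p
  to (false , p) = inj₂ p

Σ-exhaustible : ∀ {A : Set} {B : A → Set} →
  Exhaustible A → (∀ a → Exhaustible (B a)) → Exhaustible (Σ A B)
Σ-exhaustible exA exB P? =
  map′ (λ (a , b , p) → (a , b) , p) (λ ((a , b) , p) → a , b , p)
       (exA (λ a → exB a (λ b → P? (a , b))))

Vec-exhaustible : ∀ {A : Set} → Exhaustible A → ∀ k → Exhaustible (Vec A k)
Vec-exhaustible exA zero P? = map′ ([] ,_) (λ { ([] , p) → p }) (P? [])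
Vec-exhaustible exA (suc k) P? =
  map′ (λ (a , v , p) → a ∷ v , p) (λ { (a ∷ v , p) → a , v , p })
       (exA (λ a → Vec-exhaustible exA k (λ v → P? (a ∷ v))))

module _ (L : Language) where
  open Language L

  Operand-exhaustible : ∀ i → Exhaustible (Operand L i)
  Operand-exhaustible i {P} P? =
    map′ from to
      (Vec-exhaustible Bool-exhaustible width (λ c → P? (const c))
        ⊎-dec Fin.any? (λ j → P? (input j))
        ⊎-dec Fin.any? (λ j → P? (res j)))
    where
    from : (∃ λ c → P (const c)) ⊎ (∃ λ j → P (input j)) ⊎ (∃ λ j → P (res j)) → ∃ P
    from (inj₁ (c , p))        = const c , p
    from (inj₂ (inj₁ (j , p))) = input j , p
    from (inj₂ (inj₂ (j , p))) = res j , p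
    to : ∃ P → (∃ λ c → P (const c)) ⊎ (∃ λ j → P (input j)) ⊎ (∃ λ j → P (res j))
    to (const c , p) = inj₁ (c , p)
    to (input j , p) = inj₂ (inj₁ (j , p))
    to (res j , p)   = inj₂ (inj₂ (j , p))

  Instr-exhaustible : ∀ i → Exhaustible (Instr L i)
  Instr-exhaustible i =
    Σ-exhaustible Fin.any? (λ o → Vec-exhaustible (Operand-exhaustible i) (arity o))

  SSA-exhaustible : ∀ ℓ → Exhaustible (SSA L ℓ)
  SSA-exhaustible zero P? = map′ ([] ,_) (λ { ([] , p) → p }) (P? [])
  SSA-exhaustible (suc ℓ) P? =
    map′ (λ (b , ins , p) → b ∷ʳ ins , p) (λ { (b ∷ʳ ins , p) → b , ins , p })
         (SSA-exhaustible ℓ (λ b → Instr-exhaustible ℓ (λ ins → P? (b ∷ʳ ins))))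

Least : Pred ℕ 0ℓ → ℕ → Set
Least P m = ∃ λ k → k ≤ m × P k × (∀ j → j < k → ¬ P j)

least? : ∀ {P : Pred ℕ 0ℓ} → Decidable P → ∀ m → Least P m ⊎ (∀ k → k ≤ m → ¬ P k)
least? P? zero with P? zero
... | yes p  = inj₁ (zero , z≤n , p , λ _ ())
... | no ¬p  = inj₂ λ { zero z≤n → ¬p }
least? P? (suc m) with least? P? m
... | inj₁ (k , k≤m , p , below) = inj₁ (k , m≤n⇒m≤1+n k≤m , p , below)
... | inj₂ none with P? (suc m)
...   | yes p  = inj₁ (suc m , ≤-refl , p , λ { j (s≤s j≤m) → none j j≤m })
...   | no ¬p  = inj₂ λ k k≤1+m → [ (λ { (s≤s k≤m) → none k k≤m }) , (λ { refl → ¬p }) ]′ (m≤n⇒m<n∨m≡n k≤1+m)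

sumᴮ : ∀ n → (Vec Bool n → ℕ) → ℕ
sumᴮ zero    f = f []
sumᴮ (suc n) f = sumᴮ n (λ v → f (true ∷ v)) + sumᴮ n (λ v → f (false ∷ v))

sumᴮ-mono-≤ : ∀ n {f g : Vec Bool n → ℕ} → (∀ v → f v ≤ g v) → sumᴮ n f ≤ sumᴮ n g
sumᴮ-mono-≤ zero    f≤g = f≤g []
sumᴮ-mono-≤ (suc n) f≤g =
  +-mono-≤ (sumᴮ-mono-≤ n (λ v → f≤g (true ∷ v))) (sumᴮ-mono-≤ n (λ v → f≤g (false ∷ v)))

sumᴮ-mono-< : ∀ n {f g : Vec Bool n → ℕ} → (∀ v → f v ≤ g v) →
  ∀ u → f u < g u → sumᴮ n f < sumᴮ n g
sumᴮ-mono-< zero    f≤g [] fu<gu = fu<gu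
sumᴮ-mono-< (suc n) f≤g (true ∷ u) fu<gu =
  +-mono-<-≤ (sumᴮ-mono-< n (λ v → f≤g (true ∷ v)) u fu<gu) (sumᴮ-mono-≤ n (λ v → f≤g (false ∷ v)))
sumᴮ-mono-< (suc n) f≤g (false ∷ u) fu<gu =
  +-mono-≤-< (sumᴮ-mono-≤ n (λ v → f≤g (true ∷ v))) (sumᴮ-mono-< n (λ v → f≤g (false ∷ v)) u fu<gu)

isNoᴺ : ∀ {A : Set} → Dec A → ℕ
isNoᴺ (yes _) = 0
isNoᴺ (no _)  = 1

isNoᴺ-anti : ∀ {A B : Set} → (A → B) → (a? : Dec A) (b? : Dec B) → isNoᴺ b? ≤ isNoᴺ a?
isNoᴺ-anti A→B a?      (yes _) = z≤n
isNoᴺ-anti A→B (no _)  (no _)  = ≤-refl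
isNoᴺ-anti A→B (yes a) (no ¬b) = ⊥-elim (¬b (A→B a))

isNoᴺ-< : ∀ {A B : Set} → ¬ A → B → (a? : Dec A) (b? : Dec B) → isNoᴺ b? < isNoᴺ a?
isNoᴺ-< ¬a b (yes a) b?     = ⊥-elim (¬a a)
isNoᴺ-< ¬a b (no _)  (yes _) = s≤s z≤n
isNoᴺ-< ¬a b (no _)  (no ¬b) = ⊥-elim (¬b b)

module _ (L : Language) (n : ℕ) (σ : Vec Bool n → Program L → Bool) where
  open CEGIS L n σ

  _∈?_ : (x : Input) (is : List Input) → Dec (x ∈ is)
  x ∈? is = Any.any? (≡-dec _≟ᴮ_ x) is

  unseen : List Input → ℕ
  unseen is = sumᴮ n (λ y → isNoᴺ (y ∈? is))

  unseen-∷-< : ∀ {x is} → ¬ x ∈ is → unseen (x ∷ is) < unseen is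
  unseen-∷-< {x} {is} x∉is =
    sumᴮ-mono-< n (λ y → isNoᴺ-anti there (y ∈? is) (y ∈? (x ∷ is)))
                x (isNoᴺ-< x∉is (here refl) (x ∈? is) (x ∈? (x ∷ is)))

  counterexample-fresh : ∀ {is P x} → AllSat is P → σ x P ≡ false → ¬ x ∈ is
  counterexample-fresh sat σxP≡false x∈is with trans (sym σxP≡false) (All.lookup sat x∈is)
  ... | ()

  AllSat? : ∀ is P → Dec (AllSat is P)
  AllSat? is P = All.all? (λ i → σ i P ≟ᴮ true) is

  synth-progress : ∀ is → ∃ (Step (synth is))
  synth-progress is with least? (λ ℓ → SSA-exhaustible L ℓ (λ b → AllSat? is (prog ℓ b))) (2 ^ n)
  ... | inj₁ (ℓ , ℓ≤2ⁿ , (b , sat) , shorter) =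
    _ , synth-found (prog ℓ b) ℓ≤2ⁿ sat (λ { (prog k c) k<ℓ sat′ → shorter k k<ℓ (c , sat′) })
  ... | inj₂ none = _ , synth-none (λ { (prog k c) k≤2ⁿ sat → none k k≤2ⁿ (c , sat) })

  verif-progress : ∀ is P → ∃ (Step (verif is P))
  verif-progress is P with Vec-exhaustible Bool-exhaustible n (λ x → σ x P ≟ᴮ false)
  ... | yes (x , σxP≡false) = _ , verif-cex x σxP≡false
  ... | no noCex = _ , verif-ok (λ x → ¬-not (λ σxP≡false → noCex (x , σxP≡false)))

  synth-terminates : ∀ is → Acc _<_ (unseen is) → Terminates (synth is)
  synth-terminates is (acc rec) = step (synth-progress is) afterSynth
    where
    afterVerif : ∀ {P} → AllSat is P → ∀ s → Step (verif is P) s → Terminates s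
    afterVerif {P} sat _ (verif-ok _)            = done (found P)
    afterVerif     sat _ (verif-cex x σxP≡false) =
      synth-terminates (x ∷ is) (rec (unseen-∷-< (counterexample-fresh sat σxP≡false)))

    afterSynth : ∀ s → Step (synth is) s → Terminates s
    afterSynth _ (synth-found P _ sat _) = step (verif-progress is P) (afterVerif sat)
    afterSynth _ (synth-none _)          = done unsat

mainTheorem9 : (L : Language) (n : ℕ) (σ : Vec Bool n → Program L → Bool) →
    CEGIS.Terminates L n σ (CEGIS.initial L n σ)
mainTheorem9 L n σ = synth-terminates L n σ [] (<-wellFounded _)
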